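{- Let $n\ge2$, $m\ge1$, $1\le i\le j\le n-1$, and let $R,R'$ be dominant regions of the $m$-Shi arrangement in $V$ whose Shi tableaux $T_R=(e_{ab})$ and $T_{R'}=(e'_{ab})$ satisfy $e'_{ab}=e_{n-b,n-a}$ for all $1\le a\le b\le n-1$. Then $H_{\alpha_{ij},m}$ is a separating wall for $R$ if and only if $H_{\alpha_{n-j,n-i},m}$ is a separating wall for $R'$.
   Context: Let $e_1,\dots,e_n$ be the standard basis of $\mathbb R^n$ with standard inner product $\langle\cdot,\cdot\rangle$, $V=\{a\in\mathbb R^n:\sum a_i=0\}$, $\alpha_{ij}=e_i-e_{j+1}$ ($1\le i\le j\le n-1$), $\alpha_i=\alpha_{ii}$, $\theta=\alpha_{1,n-1}$, $H_{\alpha,k}=\{v\in V:\langle v,\alpha\rangle=k\}$. The $m$-Shi arrangement is $\{H_{\alpha_{ij},k}:1\le i\le j\le n-1,\ -m<k\le m\}$; regions are connected components of the complement of the union of its hyperplanes; a region is dominant if contained in $\{v:\langle v,\alpha_i\rangle\ge0\ \forall i\}$. Alcoves are components of the complement of all $H_{\alpha_{ij},k}$, $k\in\mathbb Z$; the fundamental alcove $A_0$ is the interior of $\{v:\langle v,\theta\rangle\le1,\langle v,\alpha_i\rangle\ge0\ \forall i\}$. Each region contains a unique alcove separated from $A_0$ by the fewest hyperplanes $H_{\alpha,k}$ ($k\in\mathbb Z$), its $m$-minimal alcove. The Shi coordinates of an alcove $\mathcal A$ are the integers $k_{ij}$ with $k_{ij}<\langle x,\alpha_{ij}\rangle<k_{ij}+1$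 for $x\in\mathcal A$. The Shi tableau of a region $R$ is $(e_{ij})_{1\le i\le j\le n-1}$ with $e_{ij}=\min(k_{ij},m)$ where $k_{ij}$ are the Shi coordinates of the $m$-minimal alcove of $R$. A wall of a region is a hyperplane of the $m$-Shi arrangement supporting a facet of it; it is a separating wall if the region and $A_0$ lie in different closed half-spaces determined by it.
   Formalization: Points of $V$, including those representing regions and those used for dominance, walls, separation and m-minimal alcoves, have rational coordinates, lying in ℚ^n rather than ℝ^n. -}

module Defs where

open import Data.Nat using (ℕ; zero; suc) renaming (_≤_ to _≤ℕ_; _+_ to _+ℕ_; _∸_ to _∸ℕ_)
open import Data.Integer using (ℤ; +_; -_; ∣_∣; _⊓_) renaming (_<_ to _<ℤ_; _≤_ to _≤ℤ_; _+_ to _+ℤ_)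
open import Data.Rational using (ℚ; 0ℚ; 1ℚ; _+_; _-_; _<_; _≤_; _/_)
open import Data.Fin using (Fin; zero; suc)
open import Data.List using (List; map; concatMap; upTo)
open import Data.Nat.ListAction using (sum)
open import Data.Product using (_×_; _,_; ∃; ∃-syntax; Σ)
open import Data.Sum using (_⊎_)
open import Function using (_∘_)
open import Relation.Nullary using (¬_)
open import Relation.Binary.PropositionalEquality using (_≡_; _≢_)

-- Points of ℝⁿ are modelled by their rational points (Fin n → ℚ).
Pt : ℕ → Set
Pt n = Fin n → ℚ

⟦_⟧ : ℤ → ℚ
⟦ k ⟧ = k / 1

-- 1-based coordinate  ⟨v , e_k⟩  (0 outside 1..n)
at : ∀ {n} → Pt n → ℕ → ℚ
at {zero}  v k             = 0ℚ
at {suc n} v zero          = 0ℚ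
at {suc n} v (suc zero)    = v zero
at {suc n} v (suc (suc k)) = at {n} (v ∘ suc) (suc k)

sumCoords : ∀ {n} → Pt n → ℚ
sumCoords {zero}  v = 0ℚ
sumCoords {suc n} v = v zero + sumCoords (v ∘ suc)

InV : ∀ {n} → Pt n → Set
InV v = sumCoords v ≡ 0ℚ

-- ⟨ v , α_ij ⟩ = ⟨ v , e_i - e_{j+1} ⟩
ip : ∀ {n} → Pt n → ℕ → ℕ → ℚ
ip v i j = at v i - at v (suc j)

IsRoot : ℕ → ℕ → ℕ → Set
IsRoot n i j = (1 ≤ℕ i) × (i ≤ℕ j) × (j ≤ℕ n ∸ℕ 1)

ShiHyp : ℕ → ℕ → ℕ → ℕ → ℤ → Set
ShiHyp n m i j k = IsRoot n i j × (- (+ m) <ℤ k) × (k ≤ℤ + m)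

SameSide : ℚ → ℚ → ℚ → Set
SameSide a b c = (a < c × b < c) ⊎ (c < a × c < b)

-- x lies in the complement of the m-Shi arrangement (a representative of a region)
ShiGeneric : (n m : ℕ) → Pt n → Set
ShiGeneric n m x = InV x × (∀ i j k → ShiHyp n m i j k → ¬ (ip x i j ≡ ⟦ k ⟧))

InRegion : (n m : ℕ) → Pt n → Pt n → Set
InRegion n m x y = InV y × (∀ i j k → ShiHyp n m i j k → SameSide (ip y i j) (ip x i j) ⟦ k ⟧)

Dominant : (n m : ℕ) → Pt n → Set
Dominant n m x = ∀ y → InRegion n m x y → ∀ i → 1 ≤ℕ i → i ≤ℕ n ∸ℕ 1 → 0ℚ ≤ ip y i i

InA0 : (n : ℕ) → Pt n → Set
InA0 n y = InV y × (ip y 1 (n ∸ℕ 1) < 1ℚ) × (∀ i → 1 ≤ℕ i → i ≤ℕ n ∸ℕ 1 → 0ℚ < ip y i i)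

AlcovePt : (n : ℕ) → Pt n → Set
AlcovePt n z = InV z × (∀ i j (k : ℤ) → IsRoot n i j → ¬ (ip z i j ≡ ⟦ k ⟧))

ShiCoords : (n : ℕ) → Pt n → (ℕ → ℕ → ℤ) → Set
ShiCoords n z K = ∀ i j → IsRoot n i j → (⟦ K i j ⟧ < ip z i j) × (ip z i j < ⟦ K i j +ℤ + 1 ⟧)

roots : ℕ → List (ℕ × ℕ)
roots n = concatMap (λ i → map (λ d → (i , i +ℕ d)) (upTo (n ∸ℕ i))) (map suc (upTo (n ∸ℕ 1)))

-- number of hyperplanes H_{α,k} (k ∈ ℤ) separating the alcove with Shi coordinates K from A₀:
-- for each root α_ij this number is exactly ∣ K_ij ∣
sepCount : (n : ℕ) → (ℕ → ℕ → ℤ) → ℕ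
sepCount n K = sum (map (λ { (i , j) → ∣ K i j ∣ }) (roots n))

MinimalAlcove : (n m : ℕ) → Pt n → Pt n → (ℕ → ℕ → ℤ) → Set
MinimalAlcove n m x z K =
  AlcovePt n z × InRegion n m x z × ShiCoords n z K ×
  (∀ z' K' → AlcovePt n z' → InRegion n m x z' → ShiCoords n z' K' → sepCount n K ≤ℕ sepCount n K')

ShiTableau : (n m : ℕ) → Pt n → (ℕ → ℕ → ℤ) → Set
ShiTableau n m x T = Σ (Pt n) λ z → Σ (ℕ → ℕ → ℤ) λ K →  (MinimalAlcove n m x z K × (∀ a b → IsRoot n a b → T a b ≡ K a b ⊓ + m))

IsWall : (n m : ℕ) → Pt n → ℕ → ℕ → ℤ → Set
IsWall n m x i j k = ShiHyp n m i j k × Σ (Pt n) λ y → (InV y × (ip y i j ≡ ⟦ k ⟧) ×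
  (∀ i' j' k' → ShiHyp n m i' j' k' → ¬ (i' ≡ i × j' ≡ j × k' ≡ k) →
     SameSide (ip y i' j') (ip x i' j') ⟦ k' ⟧))

Separates : (n m : ℕ) → Pt n → ℕ → ℕ → ℤ → Set
Separates n m x i j k =
  ((∀ y → InRegion n m x y → ⟦ k ⟧ ≤ ip y i j) × (∀ y → InA0 n y → ip y i j ≤ ⟦ k ⟧)) ⊎
  ((∀ y → InRegion n m x y → ip y i j ≤ ⟦ k ⟧) × (∀ y → InA0 n y → ⟦ k ⟧ ≤ ip y i j))

SeparatingWall : (n m : ℕ) → Pt n → ℕ → ℕ → ℤ → Set
SeparatingWall n m x i j k = IsWall n m x i j k × Separates n m x i j k

{-# OPTIONS --safe #-}
-- The linear involution ω(v)ₖ = −v₍ₙ₊₁₋ₖ₎ preserves V and A₀ and sends ⟨v, α_ab⟩ to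
-- ⟨ω v, α_{n−b,n−a}⟩.  The Shi tableau of a region records on which side of every hyperplane
-- of the arrangement the region lies (k ≤ e_ab iff the region is above H_{α_ab,k}), so the
-- mirrored tableaux say exactly that ω maps the region of x' onto the region of x.  Hence ω
-- transports walls and separation from one region to the other.
module Submission where

open import Defs
open import Data.Nat using (ℕ; _≤_; _∸_)
open import Data.Integer using (ℤ; +_)
open import Relation.Binary.PropositionalEquality using (_≡_)
open import Function.Bundles using (_⇔_)

open import Data.Nat using (zero; suc; _<_; s≤s; z≤n)
import Data.Nat.Properties as ℕ
open import Data.Integer using (_⊓_) renaming (_≤_ to _≤ℤ_; _<_ to _<ℤ_; _+_ to _+ℤ_)
import Data.Integer.Properties as ℤ
open import Data.Rational as ℚ using (ℚ; 0ℚ; 1ℚ; -_; _-_)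
import Data.Rational.Properties as ℚ
open import Data.Rational.Unnormalised using (mkℚᵘ; *≤*)
import Data.Rational.Unnormalised.Properties as ℚᵘ
open import Algebra.Properties.Group ℚ.+-0-group using () renaming (⁻¹-involutive to neg-involutive)
open import Data.Fin using (Fin; toℕ; fromℕ; fromℕ<; inject₁; opposite)
import Data.Fin.Properties as Fin
open import Data.Product using (_×_; _,_; proj₁; proj₂)
open import Data.Sum using (inj₁; inj₂)
open import Data.Empty using (⊥-elim)
open import Relation.Nullary using (¬_; yes; no)
open import Relation.Binary.PropositionalEquality using (refl; sym; trans; cong; cong₂; subst; subst₂; module ≡-Reasoning)
open import Function using (_∘_)
open import Function.Bundles using (mk⇔)

private variable
  n m a b i j : ℕ
  k K : ℤ
  p q r s : ℚ
  x x' y : Pt n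
  T T' : ℕ → ℕ → ℤ

⟦⟧-mono-≤ : K ≤ℤ k → ⟦ K ⟧ ℚ.≤ ⟦ k ⟧
-- ⟦ K ⟧ = K / 1 is definitionally fromℚᵘ (mkℚᵘ K 0).
⟦⟧-mono-≤ {K} {k} K≤k =
  ℚ.toℚᵘ-cancel-≤ (ℚᵘ.≤-respˡ-≃ (ℚᵘ.≃-sym (ℚ.toℚᵘ-fromℚᵘ (mkℚᵘ K 0)))
                  (ℚᵘ.≤-respʳ-≃ (ℚᵘ.≃-sym (ℚ.toℚᵘ-fromℚᵘ (mkℚᵘ k 0)))
                  (*≤* (ℤ.*-monoʳ-≤-nonNeg (+ 1) K≤k))))

neg-sub-neg : ∀ p q → (- p) - (- q) ≡ q - p
neg-sub-neg p q = trans (cong ((- p) ℚ.+_) (neg-involutive q)) (ℚ.+-comm (- p) q)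

i⊓j<k≤j⇒i<k : ∀ {i j k} → i ⊓ j <ℤ k → k ≤ℤ j → i <ℤ k
i⊓j<k≤j⇒i<k {i} {j} i⊓j<k k≤j with ℤ.≤-total i j
... | inj₁ i≤j = subst (_<ℤ _) (ℤ.i≤j⇒i⊓j≡i i≤j) i⊓j<k
... | inj₂ j≤i = ⊥-elim (ℤ.<⇒≱ (subst (_<ℤ _) (ℤ.i≥j⇒i⊓j≡j j≤i) i⊓j<k) k≤j)

suc[n∸suc[t]]≡n∸t : ∀ {t} → t < n → suc (n ∸ suc t) ≡ n ∸ t
suc[n∸suc[t]]≡n∸t t<n = sym (ℕ.+-∸-assoc 1 t<n)

SameSide-trans : SameSide p q s → SameSide q r s → SameSide p r s
SameSide-trans (inj₁ (p<s , _))   (inj₁ (_ , r<s))   = inj₁ (p<s , r<s)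
SameSide-trans (inj₁ (_ , q<s))   (inj₂ (s<q , _))   = ⊥-elim (ℚ.<-asym q<s s<q)
SameSide-trans (inj₂ (_ , s<q))   (inj₁ (q<s , _))   = ⊥-elim (ℚ.<-asym q<s s<q)
SameSide-trans (inj₂ (s<p , _))   (inj₂ (_ , s<r))   = inj₂ (s<p , s<r)

SameSide-above : SameSide p q r → r ℚ.< p → r ℚ.< q
SameSide-above (inj₁ (p<r , _)) r<p = ⊥-elim (ℚ.<-asym p<r r<p)
SameSide-above (inj₂ (_ , r<q)) _   = r<q

SameSide-below : SameSide p q r → p ℚ.< r → q ℚ.< r
SameSide-below (inj₁ (_ , q<r)) _   = q<r
SameSide-below (inj₂ (r<p , _)) p<r = ⊥-elim (ℚ.<-asym p<r r<p)

at-toℕ : (v : Pt n) (f : Fin n) → at v (suc (toℕ f)) ≡ v f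
at-toℕ {suc n} v Fin.zero    = refl
at-toℕ {suc n} v (Fin.suc f) = at-toℕ (v ∘ Fin.suc) f

ω : Pt n → Pt n
ω y f = - y (opposite f)

at-ω : (y : Pt n) {t : ℕ} → t < n → at (ω y) (suc t) ≡ - at y (n ∸ t)
at-ω {n} y {t} t<n = begin
  at (ω y) (suc t)                    ≡⟨ cong (at (ω y) ∘ suc) (sym (Fin.toℕ-fromℕ< t<n)) ⟩
  at (ω y) (suc (toℕ f))              ≡⟨ at-toℕ (ω y) f ⟩
  - y (opposite f)                    ≡⟨ cong -_ (sym (at-toℕ y (opposite f))) ⟩
  - at y (suc (toℕ (opposite f)))     ≡⟨ cong (λ t' → - at y (suc t')) (Fin.opposite-prop f) ⟩
  - at y (suc (n ∸ suc (toℕ f)))      ≡⟨ cong (λ t' → - at y (suc (n ∸ suc t'))) (Fin.toℕ-fromℕ< t<n) ⟩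
  - at y (suc (n ∸ suc t))            ≡⟨ cong (λ t' → - at y t') (suc[n∸suc[t]]≡n∸t t<n) ⟩
  - at y (n ∸ t)                      ∎
  where
  open ≡-Reasoning
  f : Fin n
  f = fromℕ< t<n

ip-ω : (y : Pt n) → 1 ≤ a → a ≤ n → b < n → ip (ω y) a b ≡ ip y (n ∸ b) (n ∸ a)
ip-ω {n} {suc a₀} {b} y _ a≤n b<n = begin
  at (ω y) (suc a₀) - at (ω y) (suc b)  ≡⟨ cong₂ _-_ (at-ω y a≤n) (at-ω y b<n) ⟩
  (- at y (n ∸ a₀)) - (- at y (n ∸ b))  ≡⟨ neg-sub-neg (at y (n ∸ a₀)) (at y (n ∸ b)) ⟩
  at y (n ∸ b) - at y (n ∸ a₀)          ≡⟨ cong (λ t → at y (n ∸ b) - at y t) (sym (suc[n∸suc[t]]≡n∸t a≤n)) ⟩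
  at y (n ∸ b) - at y (suc (n ∸ suc a₀)) ∎
  where open ≡-Reasoning

sumCoords-neg : (v : Pt n) → sumCoords (-_ ∘ v) ≡ - sumCoords v
sumCoords-neg {zero}  v = refl
sumCoords-neg {suc n} v = trans (cong (- v Fin.zero ℚ.+_) (sumCoords-neg (v ∘ Fin.suc)))
                                (sym (ℚ.neg-distrib-+ (v Fin.zero) (sumCoords (v ∘ Fin.suc))))

sumCoords-last : (v : Pt (suc n)) → sumCoords v ≡ sumCoords (v ∘ inject₁) ℚ.+ v (fromℕ n)
sumCoords-last {zero}  v = trans (ℚ.+-identityʳ (v Fin.zero)) (sym (ℚ.+-identityˡ (v Fin.zero)))
sumCoords-last {suc n} v = trans (cong (v Fin.zero ℚ.+_) (sumCoords-last (v ∘ Fin.suc)))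
                                 (sym (ℚ.+-assoc (v Fin.zero) _ _))

sumCoords-opposite : (v : Pt n) → sumCoords (v ∘ opposite) ≡ sumCoords v
sumCoords-opposite {zero}  v = refl
sumCoords-opposite {suc n} v = begin
  v (fromℕ n) ℚ.+ sumCoords (v ∘ inject₁ ∘ opposite) ≡⟨ cong (v (fromℕ n) ℚ.+_) (sumCoords-opposite (v ∘ inject₁)) ⟩
  v (fromℕ n) ℚ.+ sumCoords (v ∘ inject₁)            ≡⟨ ℚ.+-comm (v (fromℕ n)) _ ⟩
  sumCoords (v ∘ inject₁) ℚ.+ v (fromℕ n)            ≡⟨ sym (sumCoords-last v) ⟩
  sumCoords v                                         ∎
  where open ≡-Reasoning

InV-ω : InV y → InV (ω y)
InV-ω {y = y} y∈V = begin
  sumCoords (ω y)               ≡⟨ sumCoords-neg (y ∘ opposite) ⟩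
  - sumCoords (y ∘ opposite)    ≡⟨ cong -_ (sumCoords-opposite y) ⟩
  - sumCoords y                 ≡⟨ cong -_ y∈V ⟩
  0ℚ                            ∎
  where open ≡-Reasoning

IsRoot⇒< : IsRoot n a b → b < n
IsRoot⇒< {suc n} (_ , _ , b≤n) = s≤s b≤n
IsRoot⇒< {zero}  (s≤s _ , () , z≤n)

IsRoot⇒≤ : IsRoot n a b → a ≤ n
IsRoot⇒≤ root@(_ , a≤b , _) = ℕ.≤-trans a≤b (ℕ.<⇒≤ (IsRoot⇒< root))

IsRoot-mirror : IsRoot n a b → IsRoot n (n ∸ b) (n ∸ a)
IsRoot-mirror {n} root@(1≤a , a≤b , _) =
  ℕ.m<n⇒0<n∸m (IsRoot⇒< root) , ℕ.∸-monoʳ-≤ n a≤b , ℕ.∸-monoʳ-≤ n 1≤a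

mirror-involutive : IsRoot n a b → n ∸ (n ∸ b) ≡ b × n ∸ (n ∸ a) ≡ a
mirror-involutive root =
  ℕ.m∸[m∸n]≡n (ℕ.<⇒≤ (IsRoot⇒< root)) , ℕ.m∸[m∸n]≡n (IsRoot⇒≤ root)

ip-ω-root : (y : Pt n) → IsRoot n a b → ip (ω y) a b ≡ ip y (n ∸ b) (n ∸ a)
ip-ω-root y root@(1≤a , _ , _) = ip-ω y 1≤a (IsRoot⇒≤ root) (IsRoot⇒< root)

InA0-ω : InA0 n y → InA0 n (ω y)
InA0-ω {zero}          y∈A₀                  = y∈A₀
InA0-ω {suc n} {y = y} (y∈V , θ<1 , simple>0) = InV-ω {y = y} y∈V , θ<1′ , simple>0′
  where
  θ<1′ : ip (ω y) 1 n ℚ.< 1ℚ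
  θ<1′ = subst (ℚ._< 1ℚ)
    (sym (trans (ip-ω y ℕ.≤-refl (s≤s z≤n) (ℕ.n<1+n n)) (cong (λ t → ip y t n) (ℕ.m+n∸n≡m 1 n))))
    θ<1
  simple>0′ : ∀ i → 1 ≤ i → i ≤ n → 0ℚ ℚ.< ip (ω y) i i
  simple>0′ i 1≤i i≤n = subst (0ℚ ℚ.<_) (sym (ip-ω-root y root))
    (simple>0 (suc n ∸ i) (proj₁ (IsRoot-mirror root)) (proj₂ (proj₂ (IsRoot-mirror root))))
    where
    root : IsRoot (suc n) i i
    root = 1≤i , ℕ.≤-refl , i≤n

tableau-above : ShiTableau n m x T → ShiHyp n m a b k → k ≤ℤ T a b → ⟦ k ⟧ ℚ.< ip x a b
tableau-above {m = m} {a = a} {b = b} {k = k} (z , K , (_ , (_ , z~x) , zK , _) , T≡K⊓m) h@(root , _) k≤T =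
  SameSide-above (z~x a b k h) (ℚ.≤-<-trans (⟦⟧-mono-≤ k≤K) (proj₁ (zK a b root)))
  where
  k≤K : k ≤ℤ K a b
  k≤K = ℤ.≤-trans k≤T (subst (_≤ℤ K a b) (sym (T≡K⊓m a b root)) (ℤ.i⊓j≤i (K a b) (+ m)))

tableau-below : ShiTableau n m x T → ShiHyp n m a b k → T a b <ℤ k → ip x a b ℚ.< ⟦ k ⟧
tableau-below {a = a} {b = b} {k = k} (z , K , (_ , (_ , z~x) , zK , _) , T≡K⊓m) h@(root , _ , k≤m) T<k =
  SameSide-below (z~x a b k h) (ℚ.<-≤-trans (proj₂ (zK a b root)) (⟦⟧-mono-≤ K+1≤k))
  where
  K<k : K a b <ℤ k
  K<k = i⊓j<k≤j⇒i<k (subst (_<ℤ k) (T≡K⊓m a b root) T<k) k≤m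
  K+1≤k : K a b +ℤ + 1 ≤ℤ k
  K+1≤k = subst (_≤ℤ k) (ℤ.+-comm (+ 1) (K a b)) (ℤ.i<j⇒suc[i]≤j K<k)

tableau-sameSide : ShiTableau n m x T → ShiTableau n m x' T' →
                   {a' b' : ℕ} → ShiHyp n m a b k → ShiHyp n m a' b' k →
                   T a b ≡ T' a' b' → SameSide (ip x a b) (ip x' a' b') ⟦ k ⟧
tableau-sameSide {T = T} {a = a} {b = b} {k = k} x↦T x'↦T' h h' T≡T' with k ℤ.≤? T a b
... | yes k≤T = inj₂ (tableau-above x↦T h k≤T , tableau-above x'↦T' h' (subst (k ≤ℤ_) T≡T' k≤T))
... | no  k≰T = inj₁ (tableau-below x↦T h T<k , tableau-below x'↦T' h' (subst (_<ℤ k) T≡T' T<k))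
  where
  T<k : T a b <ℤ k
  T<k = ℤ.≰⇒> k≰T

MirrorTableaux : ℕ → (ℕ → ℕ → ℤ) → (ℕ → ℕ → ℤ) → Set
MirrorTableaux n T T' = ∀ a b → IsRoot n a b → T' a b ≡ T (n ∸ b) (n ∸ a)

MirrorTableaux-sym : MirrorTableaux n T T' → MirrorTableaux n T' T
MirrorTableaux-sym {n} {T} {T'} mirror a b root = begin
  T a b                       ≡⟨ sym (cong₂ T (proj₂ (mirror-involutive root)) (proj₁ (mirror-involutive root))) ⟩
  T (n ∸ (n ∸ a)) (n ∸ (n ∸ b)) ≡⟨ sym (mirror (n ∸ b) (n ∸ a) (IsRoot-mirror root)) ⟩
  T' (n ∸ b) (n ∸ a)          ∎
  where open ≡-Reasoning

MirrorTableaux⇒InRegion-ω : ShiTableau n m x T → ShiTableau n m x' T' → MirrorTableaux n T T' →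
                            InV x → InRegion n m x' (ω x)
MirrorTableaux⇒InRegion-ω {x = x} {x' = x'} x↦T x'↦T' mirror x∈V =
  InV-ω {y = x} x∈V , λ a b k h@(root , bounds) →
    subst (λ t → SameSide t (ip x' a b) ⟦ k ⟧) (sym (ip-ω-root x root))
      (tableau-sameSide x↦T x'↦T' (IsRoot-mirror root , bounds) h (sym (mirror a b root)))

InRegion-ω : InRegion n m x (ω x') → InRegion n m x' y → InRegion n m x (ω y)
InRegion-ω {n} {x = x} {x' = x'} {y = y} (_ , ωx'~x) (y∈V , y~x') =
  InV-ω {y = y} y∈V , λ a b k h@(root , bounds) →
    subst (λ t → SameSide t (ip x a b) ⟦ k ⟧) (sym (ip-ω-root y root))
      (SameSide-trans (y~x' (n ∸ b) (n ∸ a) k (IsRoot-mirror root , bounds))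
                      (subst (λ t → SameSide t (ip x a b) ⟦ k ⟧) (ip-ω-root x' root) (ωx'~x a b k h)))

IsWall-ω : InRegion n m x' (ω x) → IsRoot n i j → IsWall n m x i j k → IsWall n m x' (n ∸ j) (n ∸ i) k
IsWall-ω {n} {m} {x'} {x} {i} {j} {k} (_ , ωx~x') root ((_ , bounds) , y , y∈V , y∈H , y~x) =
  (IsRoot-mirror root , bounds) , ω y , InV-ω {y = y} y∈V , ωy∈H , ωy~x'
  where
  ωy∈H : ip (ω y) (n ∸ j) (n ∸ i) ≡ ⟦ k ⟧
  ωy∈H = trans (ip-ω-root y (IsRoot-mirror root))
               (trans (cong₂ (ip y) (proj₂ (mirror-involutive root)) (proj₁ (mirror-involutive root))) y∈H)
  ωy~x' : ∀ i' j' k' → ShiHyp n m i' j' k' → ¬ (i' ≡ n ∸ j × j' ≡ n ∸ i × k' ≡ k) →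
          SameSide (ip (ω y) i' j') (ip x' i' j') ⟦ k' ⟧
  ωy~x' i' j' k' h@(root' , bounds') other =
    subst (λ t → SameSide t (ip x' i' j') ⟦ k' ⟧) (sym (ip-ω-root y root'))
      (SameSide-trans (y~x (n ∸ j') (n ∸ i') k' (IsRoot-mirror root' , bounds') other′)
                      (subst (λ t → SameSide t (ip x' i' j') ⟦ k' ⟧) (ip-ω-root x root') (ωx~x' i' j' k' h)))
    where
    other′ : ¬ (n ∸ j' ≡ i × n ∸ i' ≡ j × k' ≡ k)
    other′ (j'↦i , i'↦j , k'≡k) =
      other (trans (sym (proj₂ (mirror-involutive root'))) (cong (n ∸_) i'↦j) ,
             trans (sym (proj₁ (mirror-involutive root'))) (cong (n ∸_) j'↦i) , k'≡k)

Separates-ω : InRegion n m x (ω x') → IsRoot n i j → Separates n m x i j k → Separates n m x' (n ∸ j) (n ∸ i) k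
Separates-ω {n} {m} {x} {x'} {i} {j} {k} ωx'∈x root (inj₁ (x≥k , A₀≤k)) = inj₁
  ( (λ y y∈x' → subst (⟦ k ⟧ ℚ.≤_) (ip-ω-root y root) (x≥k (ω y) (InRegion-ω {y = y} ωx'∈x y∈x')))
  , (λ y y∈A₀ → subst (ℚ._≤ ⟦ k ⟧) (ip-ω-root y root) (A₀≤k (ω y) (InA0-ω {y = y} y∈A₀))) )
Separates-ω {n} {m} {x} {x'} {i} {j} {k} ωx'∈x root (inj₂ (x≤k , A₀≥k)) = inj₂
  ( (λ y y∈x' → subst (ℚ._≤ ⟦ k ⟧) (ip-ω-root y root) (x≤k (ω y) (InRegion-ω {y = y} ωx'∈x y∈x')))
  , (λ y y∈A₀ → subst (⟦ k ⟧ ℚ.≤_) (ip-ω-root y root) (A₀≥k (ω y) (InA0-ω {y = y} y∈A₀))) )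

SeparatingWall-ω : InRegion n m x (ω x') → InRegion n m x' (ω x) → IsRoot n i j →
                   SeparatingWall n m x i j k → SeparatingWall n m x' (n ∸ j) (n ∸ i) k
SeparatingWall-ω {k = k} ωx'∈x ωx∈x' root (wall , separates) =
  IsWall-ω ωx∈x' root wall , Separates-ω {k = k} ωx'∈x root separates

proposition5p5 : (n m i j : ℕ) → 2 ≤ n → 1 ≤ m → IsRoot n i j →
    (x x' : Pt n) → ShiGeneric n m x → ShiGeneric n m x' →
    Dominant n m x → Dominant n m x' →
    (T T' : ℕ → ℕ → ℤ) → ShiTableau n m x T → ShiTableau n m x' T' →
    (∀ a b → IsRoot n a b → T' a b ≡ T (n ∸ b) (n ∸ a)) →
    SeparatingWall n m x i j (+ m) ⇔ SeparatingWall n m x' (n ∸ j) (n ∸ i) (+ m)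
proposition5p5 n m i j _ _ root x x' (x∈V , _) (x'∈V , _) _ _ T T' x↦T x'↦T' mirror =
  mk⇔ (SeparatingWall-ω ωx'∈x ωx∈x' root) backward
  where
  ωx∈x' : InRegion n m x' (ω x)
  ωx∈x' = MirrorTableaux⇒InRegion-ω x↦T x'↦T' mirror x∈V
  ωx'∈x : InRegion n m x (ω x')
  ωx'∈x = MirrorTableaux⇒InRegion-ω x'↦T' x↦T (MirrorTableaux-sym mirror) x'∈V
  backward : SeparatingWall n m x' (n ∸ j) (n ∸ i) (+ m) → SeparatingWall n m x i j (+ m)
  backward wall = subst₂ (λ a b → SeparatingWall n m x a b (+ m))
    (proj₂ (mirror-involutive root)) (proj₁ (mirror-involutive root))
    (SeparatingWall-ω ωx∈x' ωx'∈x (IsRoot-mirror root) wall)
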